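{- Let $n \geq 2k \geq 4$ be integers. Suppose that $\mathcal F, \mathcal G \subset \binom{[n]}{k}$ are non-trivial, cross-intersecting, initial families. Then $$|\mathcal F| + |\mathcal G| \leq k + 1 + \sum_{2 \leq i \leq k} \binom{k+1}{i}\binom{n-k-1}{k-i}.$$
   Context: $[n] = \{1,\dots,n\}$ and $\binom{[n]}{k}$ is the collection of $k$-element subsets of $[n]$. Families $\mathcal F, \mathcal G$ are cross-intersecting if $F \cap G \neq \emptyset$ for all $F \in \mathcal F$, $G \in \mathcal G$. A family $\mathcal F$ is non-trivial if $\bigcap_{F \in \mathcal F} F = \emptyset$. For $k$-sets $A = \{x_1<\dots<x_k\}$ and $B = \{y_1<\dots<y_k\}$ write $A \prec B$ if $x_i \leq y_i$ for all $1 \le i \le k$. A family $\mathcal F \subset \binom{[n]}{k}$ is initial (shifted) if $A \prec B$ and $B \in \mathcal F$ imply $A \in \mathcal F$. -}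

module Defs where

open import Data.Nat using (ℕ; zero; suc; _+_; _*_; _∸_; _≤_)
open import Data.Nat.Combinatorics using (_C_)
open import Data.Fin using (Fin; toℕ)
open import Data.Fin.Subset using (Subset; _∈_; _∉_; _∩_; ∣_∣; Nonempty)
open import Data.Vec using (Vec; []; _∷_)
open import Data.Bool using (true; false)
open import Data.List using (List; []; _∷_; map)
open import Data.List.Relation.Binary.Pointwise using (Pointwise)
import Data.List.Membership.Propositional as L
open import Data.Product using (Σ; _×_; ∃)

-- Ground set [n] is modelled by Fin n (element i ∈ [n] ↔ index i-1),
-- an order-preserving relabelling.  A subset is Data.Fin.Subset (Vec Bool n).

elems : ∀ {n} → Subset n → List ℕ
elems [] = []
elems (true ∷ p) = 0 ∷ map suc (elems p)
elems (false ∷ p) = map suc (elems p)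

_≺_ : ∀ {n} → Subset n → Subset n → Set
A ≺ B = Pointwise _≤_ (elems A) (elems B)

-- A family of k-subsets of [n]: a list of subsets, each of size k
-- (distinctness is required separately in the statement).
IsKFamily : ∀ {n} → ℕ → List (Subset n) → Set
IsKFamily {n} k 𝓕 = ∀ A → A L.∈ 𝓕 → ∣ A ∣ ≡ k
  where open import Relation.Binary.PropositionalEquality using (_≡_)

CrossIntersecting : ∀ {n} → List (Subset n) → List (Subset n) → Set
CrossIntersecting 𝓕 𝓖 = ∀ F G → F L.∈ 𝓕 → G L.∈ 𝓖 → Nonempty (F ∩ G)

-- Non-trivial: the intersection of all members is empty, i.e. every point
-- is missed by some member.
NonTrivial : ∀ {n} → List (Subset n) → Set
NonTrivial {n} 𝓕 = (x : Fin n) → Σ (Subset n) (λ F → F L.∈ 𝓕 × x ∉ F)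

Initial : ∀ {n} → ℕ → List (Subset n) → Set
Initial {n} k 𝓕 = (A B : Subset n) → ∣ A ∣ ≡ k → A ≺ B → B L.∈ 𝓕 → A L.∈ 𝓕
  where open import Relation.Binary.PropositionalEquality using (_≡_)

sumUpTo : ℕ → (ℕ → ℕ) → ℕ
sumUpTo zero g = 0
sumUpTo (suc m) g = sumUpTo m g + g m

sumFromTo : ℕ → ℕ → (ℕ → ℕ) → ℕ
sumFromTo a b f = sumUpTo (suc b ∸ a) (λ j → f (a + j))

bound : ℕ → ℕ → ℕ
bound n k = k + 1 + sumFromTo 2 k (λ i → ((k + 1) C i) * ((n ∸ k ∸ 1) C (k ∸ i)))

private
  open import Relation.Binary.PropositionalEquality using (_≡_; refl)
  test : bound 4 2 ≡ 6
  test = refl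
  test2 : bound 7 3 ≡ 4 + 6 * 3 + 4 * 1
  test2 = refl
  test3 : elems (false ∷ true ∷ false ∷ true ∷ []) ≡ 1 ∷ 3 ∷ []
  test3 = refl

{-# OPTIONS --safe #-}

-- A k-set is handled through its characteristic word, read from the largest element down.
-- Non-triviality and initiality of one family force every member of the other to meet the
-- low block [k+1] in at least two points: otherwise some k-subset Z of [k+1] misses it, and
-- Z ≺ F for any member F avoiding the element 1, so Z would belong to the first family.
-- For cross-intersecting families of j-sets meeting a block [c] in at least r points, one of
-- them shifted, |𝓐| + |𝓑| is at most the number of all such sets when 2j ≤ N and j + r ≤ c.
-- This goes by induction on N, splitting off the element N: the sets avoiding it still
-- cross-intersect, and by shiftedness so do the sets containing it, with N removed, while
-- 2j < N.  At N = 2j complementation maps 𝓑 into the complement of 𝓐 within the class.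
-- For j = k and r = 2 complements only stay in the class for r = 0, which costs the k + 1
-- sets with exactly one element in [k+1]; the remaining count is the convolution
-- Σ C(k+1,i) C(n-k-1,k-i) of the bound.

module Submission where

open import Defs
open import Data.Bool using (Bool; true; false; not) renaming (_≟_ to _≟ᵇ_)
open import Data.Bool.Properties using (not-injective)
open import Data.Empty using (⊥; ⊥-elim)
open import Data.Fin using (zero; suc)
open import Data.Fin.Subset using (Subset; ∣_∣; Nonempty; _∩_; _∉_)
open import Data.Fin.Subset.Properties using (∩-comm)
open import Data.List using (List; []; _∷_; _++_; length; map; reverse; replicate; take)
open import Data.List.Properties
  using (length-++; length-map; length-reverse; length-replicate; length-take; map-injective;
         reverse-++; unfold-reverse; reverse-injective; reverse-involutive; ++-assoc; take++drop≡id)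
open import Data.List.Membership.Propositional using (_∈_)
open import Data.List.Membership.Propositional.Properties using (∈-map⁻; ∈-map⁺)
open import Data.List.Relation.Unary.Any using (here; there)
open import Data.List.Relation.Unary.All as All using (All; []; _∷_)
import Data.List.Relation.Unary.All.Properties as Allₚ
open import Data.List.Relation.Unary.Unique.Propositional using (Unique; []; _∷_)
import Data.List.Relation.Unary.Unique.Propositional.Properties as Unique
open import Data.List.Relation.Binary.Pointwise as Pointwise using (Pointwise; []; _∷_)
open import Data.Nat using (ℕ; zero; suc; _+_; _*_; _∸_; _≤_; _<_; _⊓_; z≤n; s≤s; _≤?_; _<?_)
open import Data.Nat.Properties
open import Data.Nat.Combinatorics using (_C_; nCk+nC[k+1]≡[n+1]C[k+1]; k>n⇒nCk≡0; nC1≡n; nCn≡1)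
open import Algebra.Properties.CommutativeSemigroup +-commutativeSemigroup using (interchange; xy∙z≈xz∙y; x∙yz≈y∙xz)
open import Data.Product using (∃; ∃₂; _×_; _,_; proj₁; proj₂)
open import Data.Sum using (_⊎_; inj₁; inj₂)
open import Data.Vec using ([]; _∷_; toList; fromList; cast) renaming (here to here-at; there to there-at)
open import Data.Vec.Properties using (toList-injective; length-toList; toList-cast; toList∘fromList)
open import Data.Vec.Relation.Binary.Equality.Cast using (cast-is-id)
open import Relation.Binary.PropositionalEquality
open import Relation.Nullary using (¬_; Dec; yes; no)
open import Relation.Nullary.Decidable using (decidable-stable)

-- Characteristic words

bit : Bool → ℕ
bit true = 1
bit false = 0

ones : List Bool → ℕ
ones [] = 0
ones (x ∷ xs) = bit x + ones xs

ones-++ : ∀ xs ys → ones (xs ++ ys) ≡ ones xs + ones ys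
ones-++ [] ys = refl
ones-++ (x ∷ xs) ys = trans (cong (bit x +_) (ones-++ xs ys)) (sym (+-assoc (bit x) _ _))

ones-reverse : ∀ xs → ones (reverse xs) ≡ ones xs
ones-reverse [] = refl
ones-reverse (x ∷ xs) = begin
  ones (reverse (x ∷ xs))          ≡⟨ cong ones (unfold-reverse x xs) ⟩
  ones (reverse xs ++ x ∷ [])      ≡⟨ ones-++ (reverse xs) (x ∷ []) ⟩
  ones (reverse xs) + (bit x + 0)  ≡⟨ cong₂ _+_ (ones-reverse xs) (+-identityʳ (bit x)) ⟩
  ones xs + bit x                  ≡⟨ +-comm (ones xs) (bit x) ⟩
  ones (x ∷ xs)                    ∎
  where open ≡-Reasoning

ones-replicate : ∀ m x → ones (replicate m x) ≡ m * bit x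
ones-replicate zero x = refl
ones-replicate (suc m) x = cong (bit x +_) (ones-replicate m x)

ones-swap : ∀ xs ys zs → ones (xs ++ false ∷ ys ++ true ∷ zs) ≡ ones (xs ++ true ∷ ys ++ false ∷ zs)
ones-swap xs ys zs
  rewrite ones-++ xs (false ∷ ys ++ true ∷ zs) | ones-++ xs (true ∷ ys ++ false ∷ zs)
        | ones-++ ys (true ∷ zs) | ones-++ ys (false ∷ zs)
  = cong (ones xs +_) (+-suc (ones ys) (ones zs))

complement : List Bool → List Bool
complement = map not

ones-complement : ∀ xs → ones (complement xs) + ones xs ≡ length xs
ones-complement [] = refl
ones-complement (true ∷ xs) = trans (+-suc _ _) (cong suc (ones-complement xs))
ones-complement (false ∷ xs) = cong suc (ones-complement xs)

data Intersect : List Bool → List Bool → Set where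
  both : ∀ {xs ys} → Intersect (true ∷ xs) (true ∷ ys)
  next : ∀ {x y xs ys} → Intersect xs ys → Intersect (x ∷ xs) (y ∷ ys)

intersect? : ∀ xs ys → Dec (Intersect xs ys)
intersect? [] ys = no λ ()
intersect? (x ∷ xs) [] = no λ ()
intersect? (true ∷ xs) (true ∷ ys) = yes both
intersect? (false ∷ xs) (y ∷ ys) with intersect? xs ys
... | yes p = yes (next p)
... | no ¬p = no λ { (next p) → ¬p p }
intersect? (true ∷ xs) (false ∷ ys) with intersect? xs ys
... | yes p = yes (next p)
... | no ¬p = no λ { (next p) → ¬p p }

intersect-++⁻ : ∀ xs {xs′ ys ys′} → length xs ≡ length ys →
                Intersect (xs ++ xs′) (ys ++ ys′) → Intersect xs ys ⊎ Intersect xs′ ys′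
intersect-++⁻ [] {ys = []} _ p = inj₂ p
intersect-++⁻ (x ∷ xs) {ys = y ∷ ys} _ both = inj₁ both
intersect-++⁻ (x ∷ xs) {ys = y ∷ ys} eq (next p) with intersect-++⁻ xs (suc-injective eq) p
... | inj₁ q = inj₁ (next q)
... | inj₂ q = inj₂ q

intersect-++⁺ˡ : ∀ {xs xs′ ys ys′} → Intersect xs ys → Intersect (xs ++ xs′) (ys ++ ys′)
intersect-++⁺ˡ both = both
intersect-++⁺ˡ (next p) = next (intersect-++⁺ˡ p)

intersect-++⁺ʳ : ∀ xs {xs′ ys ys′} → length xs ≡ length ys →
                 Intersect xs′ ys′ → Intersect (xs ++ xs′) (ys ++ ys′)
intersect-++⁺ʳ [] {ys = []} _ p = p
intersect-++⁺ʳ (x ∷ xs) {ys = y ∷ ys} eq p = next (intersect-++⁺ʳ xs (suc-injective eq) p)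

intersect-reverse : ∀ {xs ys} → length xs ≡ length ys → Intersect xs ys → Intersect (reverse xs) (reverse ys)
intersect-reverse {true ∷ xs} {true ∷ ys} eq both
  rewrite unfold-reverse true xs | unfold-reverse true ys =
  intersect-++⁺ʳ (reverse xs) (trans (length-reverse xs) (trans (suc-injective eq) (sym (length-reverse ys)))) both
intersect-reverse {x ∷ xs} {y ∷ ys} eq (next p)
  rewrite unfold-reverse x xs | unfold-reverse y ys = intersect-++⁺ˡ (intersect-reverse (suc-injective eq) p)

¬intersect-complement : ∀ xs → ¬ Intersect (complement xs) xs
¬intersect-complement (x ∷ xs) (next p) = ¬intersect-complement xs p

¬intersect-falses : ∀ m {ys} → ¬ Intersect (replicate m false) ys
¬intersect-falses (suc m) (next p) = ¬intersect-falses m p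

¬intersect-ones≡0 : ∀ {xs} ys → ones ys ≡ 0 → ¬ Intersect xs ys
¬intersect-ones≡0 (true ∷ ys) () _
¬intersect-ones≡0 (false ∷ ys) eq (next p) = ¬intersect-ones≡0 ys eq p

-- Families of words and their sections

Family : Set
Family = List (List Bool)

CrossIntersect : Family → Family → Set
CrossIntersect A B = ∀ {X Y} → X ∈ A → Y ∈ B → Intersect X Y

-- Moving a one to a later position replaces an element by a smaller one.
Shifted : Family → Set
Shifted A = ∀ P Q R → P ++ true ∷ Q ++ false ∷ R ∈ A → P ++ false ∷ Q ++ true ∷ R ∈ A

section : Bool → Family → Family
section b [] = []
section b ([] ∷ A) = section b A
section b ((x ∷ X) ∷ A) with x ≟ᵇ b
... | yes _ = X ∷ section b A
... | no _ = section b A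

∈-section⁻ : ∀ b A {X} → X ∈ section b A → b ∷ X ∈ A
∈-section⁻ b ([] ∷ A) p = there (∈-section⁻ b A p)
∈-section⁻ b ((x ∷ X) ∷ A) p with x ≟ᵇ b | p
... | yes refl | here refl = here refl
... | yes _ | there q = there (∈-section⁻ b A q)
... | no _ | q = there (∈-section⁻ b A q)

∈-section⁺ : ∀ b A {X} → b ∷ X ∈ A → X ∈ section b A
∈-section⁺ b ([] ∷ A) (there p) = ∈-section⁺ b A p
∈-section⁺ b ((x ∷ X) ∷ A) p with x ≟ᵇ b | p
... | yes _ | here refl = here refl
... | yes _ | there q = there (∈-section⁺ b A q)
... | no x≢b | here refl = ⊥-elim (x≢b refl)
... | no _ | there q = ∈-section⁺ b A q

section-all : ∀ {P : List Bool → Set} b A → (∀ {X} → b ∷ X ∈ A → P X) → All P (section b A)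
section-all b A f = All.tabulate (λ X∈ → f (∈-section⁻ b A X∈))

section-unique : ∀ b {A} → Unique A → Unique (section b A)
section-unique b {[]} [] = []
section-unique b {[] ∷ A} (_ ∷ u) = section-unique b u
section-unique b {(x ∷ X) ∷ A} (X∉A ∷ u) with x ≟ᵇ b
... | yes refl = section-all b A (λ Y∈ X≡Y → All.lookup X∉A Y∈ (cong (x ∷_) X≡Y)) ∷ section-unique b u
... | no _ = section-unique b u

length-sections : ∀ {N} A → All (λ X → length X ≡ suc N) A →
                  length A ≡ length (section false A) + length (section true A)
length-sections [] [] = refl
length-sections ((false ∷ X) ∷ A) (_ ∷ ls) = cong suc (length-sections A ls)
length-sections ((true ∷ X) ∷ A) (_ ∷ ls) = trans (cong suc (length-sections A ls)) (sym (+-suc _ _))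

section-cross : ∀ b {A B} → CrossIntersect A B → CrossIntersect (section false A) (section b B)
section-cross b {A} {B} cr X∈ Y∈ with cr (∈-section⁻ false A X∈) (∈-section⁻ b B Y∈)
... | next p = p

section-shifted : ∀ b {A} → Shifted A → Shifted (section b A)
section-shifted b {A} sh P Q R p = ∈-section⁺ b A (sh (b ∷ P) Q R (∈-section⁻ b A p))

free-slot : ∀ X Y → length X ≡ length Y → ¬ Intersect X Y → ones X + ones Y < length X →
            ∃₂ λ Q R → X ≡ Q ++ false ∷ R × ¬ Intersect (Q ++ true ∷ R) Y
free-slot (true ∷ X) (true ∷ Y) _ ¬p _ = ⊥-elim (¬p both)
free-slot (false ∷ X) (false ∷ Y) _ ¬p _ = [] , X , refl , λ { (next p) → ¬p (next p) }
free-slot (true ∷ X) (false ∷ Y) eq ¬p (s≤s lt)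
  with free-slot X Y (suc-injective eq) (λ p → ¬p (next p)) lt
... | Q , R , refl , ¬q = true ∷ Q , R , refl , λ { (next q) → ¬q q }
free-slot (false ∷ X) (true ∷ Y) eq ¬p lt
  with free-slot X Y (suc-injective eq) (λ p → ¬p (next p)) (≤-pred (subst (_< suc (length X)) (+-suc (ones X) (ones Y)) lt))
... | Q , R , refl , ¬q = false ∷ Q , R , refl , λ { (next q) → ¬q q }

-- Binomial convolutions

sumUpTo-cong : ∀ m {f g} → (∀ {t} → t < m → f t ≡ g t) → sumUpTo m f ≡ sumUpTo m g
sumUpTo-cong zero f≗g = refl
sumUpTo-cong (suc m) f≗g = cong₂ _+_ (sumUpTo-cong m (λ t<m → f≗g (m<n⇒m<1+n t<m))) (f≗g ≤-refl)

sumUpTo-+ : ∀ m f g → sumUpTo m (λ t → f t + g t) ≡ sumUpTo m f + sumUpTo m g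
sumUpTo-+ zero f g = refl
sumUpTo-+ (suc m) f g = trans (cong (_+ (f m + g m)) (sumUpTo-+ m f g)) (interchange (sumUpTo m f) _ _ _)

sumUpTo-suc : ∀ m f → sumUpTo (suc m) f ≡ f 0 + sumUpTo m (λ t → f (suc t))
sumUpTo-suc zero f = +-comm 0 (f 0)
sumUpTo-suc (suc m) f = trans (cong (_+ f (suc m)) (sumUpTo-suc m f)) (+-assoc (f 0) _ _)

convolution : (ℕ → ℕ) → (ℕ → ℕ) → ℕ → ℕ
convolution a b e = sumUpTo (suc e) (λ t → a t * b (e ∸ t))

convolution-suc : ∀ a b e → convolution a b (suc e) ≡ a 0 * b (suc e) + convolution (λ t → a (suc t)) b e
convolution-suc a b e = sumUpTo-suc (suc e) (λ t → a t * b (suc e ∸ t))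

convolution-0C : ∀ a e → convolution a (0 C_) e ≡ a e
convolution-0C a e = begin
  sumUpTo e (λ t → a t * (0 C (e ∸ t))) + a e * (0 C (e ∸ e))
    ≡⟨ cong₂ _+_ (sumUpTo-cong e vanish) (cong (λ i → a e * (0 C i)) (n∸n≡0 e)) ⟩
  sumUpTo e (λ _ → 0) + a e * 1
    ≡⟨ cong₂ _+_ (sumUpTo-zero e) (*-identityʳ (a e)) ⟩
  a e ∎
  where
    open ≡-Reasoning
    vanish : ∀ {t} → t < e → a t * (0 C (e ∸ t)) ≡ 0
    vanish t<e = trans (cong (a _ *_) (k>n⇒nCk≡0 (m<n⇒0<n∸m t<e))) (*-zeroʳ (a _))
    sumUpTo-zero : ∀ m → sumUpTo m (λ _ → 0) ≡ 0
    sumUpTo-zero zero = refl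
    sumUpTo-zero (suc m) = trans (+-identityʳ _) (sumUpTo-zero m)

convolution-pascal : ∀ a M e →
  convolution a (suc M C_) (suc e) ≡ convolution a (M C_) (suc e) + convolution a (M C_) e
convolution-pascal a M e = begin
  sumUpTo (suc e) (λ t → a t * (suc M C (suc e ∸ t))) + a (suc e) * (suc M C (e ∸ e))
    ≡⟨ cong₂ _+_ (sumUpTo-cong (suc e) pascal) (cong (a (suc e) *_) top) ⟩
  sumUpTo (suc e) (λ t → a t * (M C (suc e ∸ t)) + a t * (M C (e ∸ t))) + last
    ≡⟨ cong (_+ last) (sumUpTo-+ (suc e) _ _) ⟩
  (sumUpTo (suc e) (λ t → a t * (M C (suc e ∸ t))) + convolution a (M C_) e) + last
    ≡⟨ xy∙z≈xz∙y (sumUpTo (suc e) (λ t → a t * (M C (suc e ∸ t)))) (convolution a (M C_) e) last ⟩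
  convolution a (M C_) (suc e) + convolution a (M C_) e ∎
  where
    open ≡-Reasoning
    last : ℕ
    last = a (suc e) * (M C (e ∸ e))
    top : suc M C (e ∸ e) ≡ M C (e ∸ e)
    top = trans (cong (suc M C_) (n∸n≡0 e)) (cong (M C_) (sym (n∸n≡0 e)))
    pascal : ∀ {t} → t < suc e → a t * (suc M C (suc e ∸ t)) ≡ a t * (M C (suc e ∸ t)) + a t * (M C (e ∸ t))
    pascal {t} t≤e = begin
      a t * (suc M C (suc e ∸ t))                 ≡⟨ cong (λ i → a t * (suc M C i)) (+-∸-assoc 1 (≤-pred t≤e)) ⟩
      a t * (suc M C suc (e ∸ t))                 ≡⟨ cong (a t *_) (nCk+nC[k+1]≡[n+1]C[k+1] M (e ∸ t)) ⟨
      a t * ((M C (e ∸ t)) + (M C suc (e ∸ t)))   ≡⟨ cong (a t *_) (+-comm (M C (e ∸ t)) _) ⟩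
      a t * ((M C suc (e ∸ t)) + (M C (e ∸ t)))   ≡⟨ *-distribˡ-+ (a t) _ _ ⟩
      a t * (M C suc (e ∸ t)) + a t * (M C (e ∸ t)) ≡⟨ cong (λ i → a t * (M C i) + a t * (M C (e ∸ t))) (+-∸-assoc 1 (≤-pred t≤e)) ⟨
      a t * (M C (suc e ∸ t)) + a t * (M C (e ∸ t)) ∎

-- Words with many ones in the low block

module LowBlock (c : ℕ) where

  -- An entry followed by m further entries stands for the element m (counting from 0);
  -- it lies in the low block iff m < c.  Removing a top entry at height m leaves
  -- lowered m r of a requirement of r low elements.
  lowBit : ℕ → Bool → ℕ
  lowBit m false = 0
  lowBit m true with m <? c
  ... | yes _ = 1
  ... | no _ = 0

  low : List Bool → ℕ
  low [] = 0
  low (x ∷ xs) = lowBit (length xs) x + low xs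

  lowered : ℕ → ℕ → ℕ
  lowered m r with m <? c
  ... | yes _ = r ∸ 1
  ... | no _ = r

  lowered≤ : ∀ m r → lowered m r ≤ r
  lowered≤ m r with m <? c
  ... | yes _ = m∸n≤m r 1
  ... | no _ = ≤-refl

  lowered-high : ∀ {m} r → c ≤ m → lowered m r ≡ r
  lowered-high {m} r c≤m with m <? c
  ... | yes m<c = ⊥-elim (<⇒≱ m<c c≤m)
  ... | no _ = refl

  lowered-low : ∀ {m} r → m < c → lowered m r ≡ r ∸ 1
  lowered-low {m} r m<c with m <? c
  ... | yes _ = refl
  ... | no m≮c = ⊥-elim (m≮c m<c)

  low-tail : ∀ r xs → r ≤ low (true ∷ xs) → lowered (length xs) r ≤ low xs
  low-tail r xs r≤ with length xs <? c
  ... | yes _ = ∸-monoˡ-≤ 1 r≤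
  ... | no _ = r≤

  low≤ones : ∀ xs → low xs ≤ ones xs
  low≤ones [] = z≤n
  low≤ones (false ∷ xs) = low≤ones xs
  low≤ones (true ∷ xs) with length xs <? c
  ... | yes _ = s≤s (low≤ones xs)
  ... | no _ = m≤n⇒m≤1+n (low≤ones xs)

  ⊓-suc-below : ∀ {m} → m < c → suc (m ⊓ c) ≡ suc m ⊓ c
  ⊓-suc-below m<c = trans (cong suc (m≤n⇒m⊓n≡m (<⇒≤ m<c))) (sym (m≤n⇒m⊓n≡m m<c))

  ⊓-suc-above : ∀ {m} → c ≤ m → m ⊓ c ≡ suc m ⊓ c
  ⊓-suc-above c≤m = trans (m≥n⇒m⊓n≡n c≤m) (sym (m≥n⇒m⊓n≡n (m≤n⇒m≤1+n c≤m)))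

  low-complement : ∀ xs → low (complement xs) + low xs ≡ length xs ⊓ c
  low-complement [] = refl
  low-complement (false ∷ xs) rewrite length-map not xs with length xs <? c
  ... | yes m<c = trans (cong suc (low-complement xs)) (⊓-suc-below m<c)
  ... | no m≮c = trans (low-complement xs) (⊓-suc-above (≮⇒≥ m≮c))
  low-complement (true ∷ xs) with length xs <? c
  ... | yes m<c = trans (+-suc _ _) (trans (cong suc (low-complement xs)) (⊓-suc-below m<c))
  ... | no m≮c = trans (low-complement xs) (⊓-suc-above (≮⇒≥ m≮c))

  -- count N j r counts the j-subsets of [N] with at least r low elements,
  -- countTop N j r those among them that contain the top element.
  count : ℕ → ℕ → ℕ → ℕ
  countTop : ℕ → ℕ → ℕ → ℕ

  count zero zero zero = 1
  count zero zero (suc r) = 0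
  count zero (suc j) r = 0
  count (suc N) j r = count N j r + countTop N j r

  countTop N zero r = 0
  countTop N (suc j) r = count N j (lowered N r)

  record Admissible (N j r : ℕ) (X : List Bool) : Set where
    constructor admissible
    field
      length≡ : length X ≡ N
      ones≡ : ones X ≡ j
      low≥ : r ≤ low X

  open Admissible

  section-false-admissible : ∀ {N j r} A → All (Admissible (suc N) j r) A →
                             All (Admissible N j r) (section false A)
  section-false-admissible A adm = section-all false A λ X∈ →
    let a = All.lookup adm X∈ in admissible (suc-injective (length≡ a)) (ones≡ a) (low≥ a)

  section-true-admissible : ∀ {N j r} A → All (Admissible (suc N) (suc j) r) A →
                            All (Admissible N j (lowered N r)) (section true A)
  section-true-admissible {N} {r = r} A adm = section-all true A λ {X} X∈ →
    let a = All.lookup adm X∈ in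
    admissible (suc-injective (length≡ a)) (suc-injective (ones≡ a))
               (subst (λ m → lowered m r ≤ low X) (suc-injective (length≡ a)) (low-tail r X (low≥ a)))

  section-true-empty : ∀ {N r} A → All (Admissible (suc N) zero r) A → length (section true A) ≡ 0
  section-true-empty A adm = empty (section-all true A λ {X} X∈ → ones-true≢0 {X} (ones≡ (All.lookup adm X∈)))
    where
      ones-true≢0 : ∀ {X} → ones (true ∷ X) ≡ 0 → ⊥
      ones-true≢0 ()
      empty : ∀ {A : Family} → All (λ _ → ⊥) A → length A ≡ 0
      empty [] = refl

  length≤count : ∀ N j r {A} → Unique A → All (Admissible N j r) A → length A ≤ count N j r
  length≤count zero j r {[]} _ _ = z≤n
  length≤count zero j r {[] ∷ []} _ (admissible _ refl z≤n ∷ _) = ≤-refl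
  length≤count zero j r {[] ∷ [] ∷ A} ((≢[] ∷ _) ∷ _) _ = ⊥-elim (≢[] refl)
  length≤count zero j r {[] ∷ (_ ∷ _) ∷ A} _ (_ ∷ admissible () _ _ ∷ _)
  length≤count zero j r {(_ ∷ _) ∷ A} _ (admissible () _ _ ∷ _)
  length≤count (suc N) j r {A} u adm = begin
    length A                                            ≡⟨ length-sections A (All.map length≡ adm) ⟩
    length (section false A) + length (section true A)  ≤⟨ +-mono-≤ below (above j adm) ⟩
    count N j r + countTop N j r                        ∎
    where
      open ≤-Reasoning
      below : length (section false A) ≤ count N j r
      below = length≤count N j r (section-unique false u) (section-false-admissible A adm)
      above : ∀ j → All (Admissible (suc N) j r) A → length (section true A) ≤ countTop N j r
      above zero adm = ≤-reflexive (section-true-empty A adm)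
      above (suc j) adm = length≤count N j _ (section-unique true u) (section-true-admissible A adm)

  admissible-complement : ∀ {N j r X} → j + j ≡ N → j + r ≤ c →
                          Admissible N j r X → Admissible N j r (complement X)
  admissible-complement {N} {j} {r} {X} 2j≡N j+r≤c (admissible refl refl r≤low) =
    admissible (length-map not X) ones-compl (+-cancelʳ-≤ (low X) r (low (complement X)) r+low≤)
    where
      ones-compl : ones (complement X) ≡ ones X
      ones-compl = +-cancelʳ-≡ (ones X) _ _ (trans (ones-complement X) (sym 2j≡N))
      r≤j : r ≤ ones X
      r≤j = ≤-trans r≤low (low≤ones X)
      r+low≤ : r + low X ≤ low (complement X) + low X
      r+low≤ = begin
        r + low X                   ≤⟨ +-monoʳ-≤ r (low≤ones X) ⟩
        r + ones X                  ≡⟨ +-comm r (ones X) ⟩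
        ones X + r                  ≤⟨ ⊓-glb (≤-trans (+-monoʳ-≤ (ones X) r≤j) (≤-reflexive 2j≡N)) j+r≤c ⟩
        length X ⊓ c                ≡⟨ low-complement X ⟨
        low (complement X) + low X  ∎
        where open ≤-Reasoning

  -- Since j + r ≤ c, complements of admissible words are admissible, and cross-intersection
  -- keeps them out of A.
  balanced-cross-bound : ∀ {N j r A B} → j + j ≡ N → j + r ≤ c → Unique A → Unique B →
                         All (Admissible N j r) A → All (Admissible N j r) B → CrossIntersect A B →
                         length A + length B ≤ count N j r
  balanced-cross-bound {N} {j} {r} {A} {B} 2j≡N j+r≤c uA uB admA admB cr = begin
    length A + length B                    ≡⟨ cong (length A +_) (length-map complement B) ⟨
    length A + length (map complement B)   ≡⟨ length-++ A ⟨
    length (A ++ map complement B)         ≤⟨ length≤count N j r unique admissible-all ⟩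
    count N j r                            ∎
    where
      open ≤-Reasoning
      disjoint : ∀ {X} → ¬ (X ∈ A × X ∈ map complement B)
      disjoint (X∈A , X∈B̅) with ∈-map⁻ complement X∈B̅
      ... | Y , Y∈B , refl = ¬intersect-complement Y (cr X∈A Y∈B)
      unique : Unique (A ++ map complement B)
      unique = Unique.++⁺ uA (Unique.map⁺ (map-injective not-injective) uB) disjoint
      admissible-all : All (Admissible N j r) (A ++ map complement B)
      admissible-all = Allₚ.++⁺ admA (Allₚ.map⁺ (All.map (admissible-complement 2j≡N j+r≤c) admB))

  -- Were X and Y disjoint, they would share a zero (2j < N); shifting the top one of true ∷ X
  -- there gives a member of A missing true ∷ Y.
  section-true-cross : ∀ {N j r A B} →
    All (Admissible (suc N) (suc j) r) A → All (Admissible (suc N) (suc j) r) B →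
    CrossIntersect A B → Shifted A → j + j < N → CrossIntersect (section true A) (section true B)
  section-true-cross {N} {j} {r} {A} {B} admA admB cr sh 2j<N {X} {Y} X∈ Y∈ =
    decidable-stable (intersect? X Y) ¬¬intersect
    where
      aX : Admissible (suc N) (suc j) r (true ∷ X)
      aX = All.lookup admA (∈-section⁻ true A X∈)
      aY : Admissible (suc N) (suc j) r (true ∷ Y)
      aY = All.lookup admB (∈-section⁻ true B Y∈)
      length-X≡Y : length X ≡ length Y
      length-X≡Y = trans (suc-injective (length≡ aX)) (sym (suc-injective (length≡ aY)))
      sparse : ones X + ones Y < length X
      sparse = subst₂ (λ a b → a + b < length X) (sym (suc-injective (ones≡ aX))) (sym (suc-injective (ones≡ aY)))
                      (subst (j + j <_) (sym (suc-injective (length≡ aX))) 2j<N)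
      ¬¬intersect : ¬ ¬ Intersect X Y
      ¬¬intersect ¬p with free-slot X Y length-X≡Y ¬p sparse
      ... | Q , R , X≡ , ¬q
        with cr (sh [] Q R (subst (λ Z → true ∷ Z ∈ A) X≡ (∈-section⁻ true A X∈))) (∈-section⁻ true B Y∈)
      ... | next q = ¬q q

  sections-bound : ∀ {N j r A B x y} → All (Admissible (suc N) j r) A → All (Admissible (suc N) j r) B →
    length (section false A) + length (section false B) ≤ x →
    length (section true A) + length (section true B) ≤ y →
    length A + length B ≤ x + y
  sections-bound {A = A} {B} {x} {y} admA admB below above = begin
    length A + length B
      ≡⟨ cong₂ _+_ (length-sections A (All.map length≡ admA)) (length-sections B (All.map length≡ admB)) ⟩
    (length (section false A) + length (section true A)) + (length (section false B) + length (section true B))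
      ≡⟨ interchange (length (section false A)) _ _ _ ⟩
    (length (section false A) + length (section false B)) + (length (section true A) + length (section true B))
      ≤⟨ +-mono-≤ below above ⟩
    x + y ∎
    where open ≤-Reasoning

  cross-bound : ∀ N j r {A B} → Unique A → Unique B →
    All (Admissible N j r) A → All (Admissible N j r) B → CrossIntersect A B → Shifted A →
    j + j ≤ N → j + r ≤ c → length A + length B ≤ count N j r
  cross-bound N j r uA uB admA admB cr sh 2j≤N j+r≤c with j + j ≟ N
  ... | yes 2j≡N = balanced-cross-bound 2j≡N j+r≤c uA uB admA admB cr
  cross-bound zero j r _ _ _ _ _ _ 2j≤0 _ | no 2j≢0 = ⊥-elim (2j≢0 (n≤0⇒n≡0 2j≤0))
  cross-bound (suc N) j r {A} {B} uA uB admA admB cr sh 2j≤1+N j+r≤c | no 2j≢1+N =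
    sections-bound admA admB
      (cross-bound N j r (section-unique false uA) (section-unique false uB)
         (section-false-admissible A admA) (section-false-admissible B admB)
         (section-cross false cr) (section-shifted false sh) 2j≤N j+r≤c)
      (above j admA admB 2j≤N j+r≤c)
    where
      2j≤N : j + j ≤ N
      2j≤N = ≤-pred (≤∧≢⇒< 2j≤1+N 2j≢1+N)
      above : ∀ j → All (Admissible (suc N) j r) A → All (Admissible (suc N) j r) B → j + j ≤ N → j + r ≤ c →
              length (section true A) + length (section true B) ≤ countTop N j r
      above zero admA admB _ _ = ≤-reflexive (cong₂ _+_ (section-true-empty A admA) (section-true-empty B admB))
      above (suc j) admA admB 2j+2≤N j+r≤c =
        cross-bound N j (lowered N r) (section-unique true uA) (section-unique true uB)
          (section-true-admissible A admA) (section-true-admissible B admB)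
          (section-true-cross admA admB cr sh 2j<N) (section-shifted true sh)
          (<⇒≤ 2j<N) (≤-trans (+-mono-≤ (n≤1+n j) (lowered≤ N r)) j+r≤c)
        where
          2j<N : j + j < N
          2j<N = ≤-trans (s≤s (+-monoʳ-≤ j (n≤1+n j))) 2j+2≤N

  count≡0 : ∀ N {j r} → j < r → count N j r ≡ 0
  count≡0 zero {zero} {suc r} _ = refl
  count≡0 zero {suc j} _ = refl
  count≡0 (suc N) {zero} j<r = trans (+-identityʳ _) (count≡0 N j<r)
  count≡0 (suc N) {suc j} {r} j<r =
    cong₂ _+_ (count≡0 N j<r) (count≡0 N (<-≤-trans (∸-monoˡ-< j<r (s≤s z≤n)) (∸1≤lowered N r)))
    where
      ∸1≤lowered : ∀ m r → r ∸ 1 ≤ lowered m r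
      ∸1≤lowered m r with m <? c
      ... | yes _ = ≤-refl
      ... | no _ = m∸n≤m r 1

  count≡C : ∀ N {j r} → N ≤ c → r ≤ j → count N j r ≡ N C j
  count≡C zero {zero} {zero} _ _ = refl
  count≡C zero {suc j} _ _ = refl
  count≡C (suc N) {zero} N<c r≤0 = trans (+-identityʳ _) (count≡C N (<⇒≤ N<c) r≤0)
  count≡C (suc N) {suc j} {r} N<c r≤1+j = begin
    count N (suc j) r + count N j (lowered N r)
      ≡⟨ cong (λ r′ → count N (suc j) r + count N j r′) (lowered-low r N<c) ⟩
    count N (suc j) r + count N j (r ∸ 1)
      ≡⟨ cong₂ _+_ (count≡C N (<⇒≤ N<c) r≤1+j) (count≡C N (<⇒≤ N<c) (∸-monoˡ-≤ 1 r≤1+j)) ⟩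
    N C suc j + N C j  ≡⟨ +-comm (N C suc j) _ ⟩
    N C j + N C suc j  ≡⟨ nCk+nC[k+1]≡[n+1]C[k+1] N j ⟩
    suc N C suc j      ∎
    where open ≡-Reasoning

  countTop≡0 : ∀ N {j r} → c ≤ N → j ≤ r → countTop N j r ≡ 0
  countTop≡0 N {zero} _ _ = refl
  countTop≡0 N {suc j} {r} c≤N j<r = trans (cong (count N j) (lowered-high r c≤N)) (count≡0 N j<r)

  count≡convolution : ∀ M r e → count (c + M) (r + e) r ≡ convolution (λ t → c C (r + t)) (M C_) e
  count≡convolution zero r e = begin
    count (c + 0) (r + e) r          ≡⟨ cong (λ N → count N (r + e) r) (+-identityʳ c) ⟩
    count c (r + e) r                ≡⟨ count≡C c ≤-refl (m≤m+n r e) ⟩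
    c C (r + e)                      ≡⟨ convolution-0C (λ t → c C (r + t)) e ⟨
    convolution (λ t → c C (r + t)) (0 C_) e ∎
    where open ≡-Reasoning
  count≡convolution (suc M) r e = begin
    count (c + suc M) (r + e) r
      ≡⟨ cong (λ N → count N (r + e) r) (+-suc c M) ⟩
    count (c + M) (r + e) r + countTop (c + M) (r + e) r
      ≡⟨ cong (_+ countTop (c + M) (r + e) r) (count≡convolution M r e) ⟩
    convolution a (M C_) e + countTop (c + M) (r + e) r
      ≡⟨ add-top e ⟩
    convolution a (suc M C_) e ∎
    where
      open ≡-Reasoning
      a : ℕ → ℕ
      a t = c C (r + t)
      c≤c+M : c ≤ c + M
      c≤c+M = m≤m+n c M
      add-top : ∀ e → convolution a (M C_) e + countTop (c + M) (r + e) r ≡ convolution a (suc M C_) e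
      add-top zero = trans (cong (convolution a (M C_) 0 +_) (countTop≡0 (c + M) c≤c+M (≤-reflexive (+-identityʳ r)))) (+-identityʳ _)
      add-top (suc e) = begin
        convolution a (M C_) (suc e) + countTop (c + M) (r + suc e) r
          ≡⟨ cong (λ j → convolution a (M C_) (suc e) + countTop (c + M) j r) (+-suc r e) ⟩
        convolution a (M C_) (suc e) + count (c + M) (r + e) (lowered (c + M) r)
          ≡⟨ cong (λ r′ → convolution a (M C_) (suc e) + count (c + M) (r + e) r′) (lowered-high r c≤c+M) ⟩
        convolution a (M C_) (suc e) + count (c + M) (r + e) r
          ≡⟨ cong (convolution a (M C_) (suc e) +_) (count≡convolution M r e) ⟩
        convolution a (M C_) (suc e) + convolution a (M C_) e
          ≡⟨ convolution-pascal a M e ⟨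
        convolution a (suc M C_) (suc e) ∎

-- The critical case j = k, r = 2, where j + r = c + 1

module Critical (e : ℕ) where

  k : ℕ
  k = suc (suc e)

  open LowBlock (k + 1)
  open Admissible

  count≡bound-sum : ∀ {n} → k + 1 ≤ n → count n k 2 ≡ sumFromTo 2 k (λ i → ((k + 1) C i) * ((n ∸ k ∸ 1) C (k ∸ i)))
  count≡bound-sum {n} c≤n = begin
    count n k 2                          ≡⟨ cong (λ N → count N k 2) c+M≡n ⟨
    count ((k + 1) + (n ∸ k ∸ 1)) k 2    ≡⟨ count≡convolution (n ∸ k ∸ 1) 2 e ⟩
    sumFromTo 2 k (λ i → ((k + 1) C i) * ((n ∸ k ∸ 1) C (k ∸ i))) ∎
    where
      open ≡-Reasoning
      c+M≡n : (k + 1) + (n ∸ k ∸ 1) ≡ n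
      c+M≡n = trans (cong ((k + 1) +_) (∸-+-assoc n k 1)) (m+[n∸m]≡n c≤n)

  count[k+k,k,0]≡k+1+count[k+k,k,2] : count (k + k) k 0 ≡ k + 1 + count (k + k) k 2
  count[k+k,k,0]≡k+1+count[k+k,k,2] = begin
    count (k + k) k 0
      ≡⟨ cong (λ N → count N k 0) c+M≡2k ⟨
    count (c + M) k 0
      ≡⟨ count≡convolution M 0 k ⟩
    convolution (c C_) (M C_) k
      ≡⟨ convolution-suc (c C_) (M C_) (suc e) ⟩
    (c C 0) * (M C k) + convolution (λ t → c C suc t) (M C_) (suc e)
      ≡⟨ cong₂ _+_ (cong ((c C 0) *_) (k>n⇒nCk≡0 (n<1+n M))) (convolution-suc (λ t → c C suc t) (M C_) e) ⟩
    (c C 0) * 0 + ((c C 1) * (M C M) + convolution (λ t → c C (2 + t)) (M C_) e)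
      ≡⟨ cong₂ _+_ (*-zeroʳ (c C 0)) (cong₂ _+_ (cong₂ _*_ (nC1≡n c) (nCn≡1 M)) (sym (count≡convolution M 2 e))) ⟩
    0 + (c * 1 + count (c + M) k 2)
      ≡⟨ cong (_+ count (c + M) k 2) (*-identityʳ c) ⟩
    c + count (c + M) k 2
      ≡⟨ cong (λ N → c + count N k 2) c+M≡2k ⟩
    k + 1 + count (k + k) k 2 ∎
    where
      open ≡-Reasoning
      c M : ℕ
      c = k + 1
      M = suc e
      c+M≡2k : c + M ≡ k + k
      c+M≡2k = +-assoc k 1 M

  critical-cross-bound : ∀ N {A B} → Unique A → Unique B →
    All (Admissible N k 2) A → All (Admissible N k 2) B → CrossIntersect A B → Shifted A →
    k + k ≤ N → length A + length B ≤ k + 1 + count N k 2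
  critical-cross-bound N {A} {B} uA uB admA admB cr sh 2k≤N with k + k ≟ N
  ... | yes refl = begin
    length A + length B  ≤⟨ balanced-cross-bound refl (+-monoʳ-≤ k z≤n) uA uB (weaken admA) (weaken admB) cr ⟩
    count (k + k) k 0    ≡⟨ count[k+k,k,0]≡k+1+count[k+k,k,2] ⟩
    k + 1 + count (k + k) k 2 ∎
    where
      open ≤-Reasoning
      weaken : ∀ {A} → All (Admissible N k 2) A → All (Admissible N k 0) A
      weaken = All.map λ a → admissible (length≡ a) (ones≡ a) z≤n
  critical-cross-bound zero _ _ _ _ _ _ () | no _
  critical-cross-bound (suc N) {A} {B} uA uB admA admB cr sh 2k≤1+N | no 2k≢1+N = begin
    length A + length B
      ≤⟨ sections-bound admA admB
           (critical-cross-bound N (section-unique false uA) (section-unique false uB)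
              (section-false-admissible A admA) (section-false-admissible B admB)
              (section-cross false cr) (section-shifted false sh) 2k≤N)
           (cross-bound N (suc e) 2 (section-unique true uA) (section-unique true uB)
              (section-true-admissible′ A admA) (section-true-admissible′ B admB)
              (section-true-cross admA admB cr sh 2j<N) (section-shifted true sh)
              (<⇒≤ 2j<N) (≤-reflexive (cong suc (+-suc e 1)))) ⟩
    (k + 1 + count N k 2) + count N (suc e) 2
      ≡⟨ +-assoc (k + 1) _ _ ⟩
    k + 1 + (count N k 2 + count N (suc e) 2)
      ≡⟨ cong (λ r → k + 1 + (count N k 2 + count N (suc e) r)) lowered≡2 ⟨
    k + 1 + count (suc N) k 2 ∎
    where
      open ≤-Reasoning
      2k≤N : k + k ≤ N
      2k≤N = ≤-pred (≤∧≢⇒< 2k≤1+N 2k≢1+N)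
      2j<N : suc e + suc e < N
      2j<N = <-≤-trans (+-mono-< (n<1+n (suc e)) (n<1+n (suc e))) 2k≤N
      lowered≡2 : lowered N 2 ≡ 2
      lowered≡2 = lowered-high 2 (≤-trans (+-monoʳ-≤ k (s≤s z≤n)) 2k≤N)
      section-true-admissible′ : ∀ A → All (Admissible (suc N) k 2) A → All (Admissible N (suc e) 2) (section true A)
      section-true-admissible′ A adm = subst (λ r → All (Admissible N (suc e) r) (section true A)) lowered≡2
                                              (section-true-admissible A adm)

-- Subsets as words

low-zero : ∀ xs → LowBlock.low 0 xs ≡ 0
low-zero [] = refl
low-zero (false ∷ xs) = low-zero xs
low-zero (true ∷ xs) = low-zero xs

lowBit-suc : ∀ c m x → LowBlock.lowBit (suc c) (suc m) x ≡ LowBlock.lowBit c m x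
lowBit-suc c m false = refl
lowBit-suc c m true with suc m <? suc c | m <? c
... | yes _ | yes _ = refl
... | no _ | no _ = refl
... | yes 1+m<1+c | no m≮c = ⊥-elim (m≮c (≤-pred 1+m<1+c))
... | no 1+m≮1+c | yes m<c = ⊥-elim (1+m≮1+c (s≤s m<c))

low-snoc : ∀ c xs x → LowBlock.low (suc c) (xs ++ x ∷ []) ≡ bit x + LowBlock.low c xs
low-snoc c [] false = refl
low-snoc c [] true = refl
low-snoc c (y ∷ xs) x = begin
  lowBit (suc c) (length (xs ++ x ∷ [])) y + low (suc c) (xs ++ x ∷ [])
    ≡⟨ cong₂ _+_ (cong (λ m → lowBit (suc c) m y) (trans (length-++ xs) (+-comm (length xs) 1))) (low-snoc c xs x) ⟩
  lowBit (suc c) (suc (length xs)) y + (bit x + low c xs)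
    ≡⟨ cong (_+ (bit x + low c xs)) (lowBit-suc c (length xs) y) ⟩
  lowBit c (length xs) y + (bit x + low c xs)
    ≡⟨ x∙yz≈y∙xz (lowBit c (length xs) y) (bit x) _ ⟩
  bit x + low c (y ∷ xs) ∎
  where
    open ≡-Reasoning
    open LowBlock using (low; lowBit)

low-reverse : ∀ c xs → LowBlock.low c (reverse xs) ≡ ones (take c xs)
low-reverse zero xs = low-zero (reverse xs)
low-reverse (suc c) [] = refl
low-reverse (suc c) (x ∷ xs) = begin
  LowBlock.low (suc c) (reverse (x ∷ xs))    ≡⟨ cong (LowBlock.low (suc c)) (unfold-reverse x xs) ⟩
  LowBlock.low (suc c) (reverse xs ++ x ∷ []) ≡⟨ low-snoc c (reverse xs) x ⟩
  bit x + LowBlock.low c (reverse xs)         ≡⟨ cong (bit x +_) (low-reverse c xs) ⟩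
  ones (take (suc c) (x ∷ xs))                ∎
  where open ≡-Reasoning

word : ∀ {n} → Subset n → List Bool
word X = reverse (toList X)

length-word : ∀ {n} (X : Subset n) → length (word X) ≡ n
length-word X = trans (length-reverse (toList X)) (length-toList X)

word-injective : ∀ {n} {X Y : Subset n} → word X ≡ word Y → X ≡ Y
word-injective {X = X} {Y} eq = trans (sym (cast-is-id refl X)) (toList-injective refl X Y (reverse-injective eq))

ones-toList : ∀ {n} (X : Subset n) → ones (toList X) ≡ ∣ X ∣
ones-toList [] = refl
ones-toList (true ∷ X) = cong suc (ones-toList X)
ones-toList (false ∷ X) = ones-toList X

ones-word : ∀ {n} (X : Subset n) → ones (word X) ≡ ∣ X ∣
ones-word X = trans (ones-reverse (toList X)) (ones-toList X)

intersect-toList : ∀ {n} (X Y : Subset n) → Nonempty (X ∩ Y) → Intersect (toList X) (toList Y)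
intersect-toList (true ∷ X) (true ∷ Y) (zero , here-at) = both
intersect-toList (x ∷ X) (y ∷ Y) (suc i , there-at i∈) = next (intersect-toList X Y (i , i∈))

word-cross : ∀ {n} {𝓐 𝓑 : List (Subset n)} → CrossIntersecting 𝓐 𝓑 → CrossIntersect (map word 𝓐) (map word 𝓑)
word-cross {𝓐 = 𝓐} {𝓑} cr X∈ Y∈ with ∈-map⁻ word X∈ | ∈-map⁻ word Y∈
... | X , X∈𝓐 , refl | Y , Y∈𝓑 , refl =
  intersect-reverse (trans (length-toList X) (sym (length-toList Y))) (intersect-toList X Y (cr X Y X∈𝓐 Y∈𝓑))

indices : List Bool → List ℕ
indices [] = []
indices (true ∷ xs) = 0 ∷ map suc (indices xs)
indices (false ∷ xs) = map suc (indices xs)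

elems-toList : ∀ {n} (X : Subset n) → elems X ≡ indices (toList X)
elems-toList [] = refl
elems-toList (true ∷ X) = cong (λ is → 0 ∷ map suc is) (elems-toList X)
elems-toList (false ∷ X) = cong (map suc) (elems-toList X)

infix 4 _≤*_
_≤*_ : List ℕ → List ℕ → Set
_≤*_ = Pointwise _≤_

≤*-trans : ∀ {is js ks} → is ≤* js → js ≤* ks → is ≤* ks
≤*-trans = Pointwise.transitive ≤-trans

≤*-suc : ∀ {is js} → is ≤* js → map suc is ≤* map suc js
≤*-suc [] = []
≤*-suc (i≤j ∷ is≤js) = s≤s i≤j ∷ ≤*-suc is≤js

≤*-map-suc : ∀ is → is ≤* map suc is
≤*-map-suc [] = []
≤*-map-suc (i ∷ is) = n≤1+n i ∷ ≤*-map-suc is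

indices-insert : ∀ xs ys → ∃₂ λ i is → indices (xs ++ true ∷ ys) ≡ i ∷ is × indices (xs ++ false ∷ ys) ≤* is
indices-insert [] ys = 0 , map suc (indices ys) , refl , Pointwise.refl ≤-refl
indices-insert (true ∷ xs) ys with indices-insert xs ys
... | i , is , eq , ≤is rewrite eq = 0 , suc i ∷ map suc is , refl , z≤n ∷ ≤*-suc ≤is
indices-insert (false ∷ xs) ys with indices-insert xs ys
... | i , is , eq , ≤is rewrite eq = suc i , map suc is , refl , ≤*-suc ≤is

indices-shift : ∀ xs ys zs → indices (xs ++ true ∷ ys ++ false ∷ zs) ≤* indices (xs ++ false ∷ ys ++ true ∷ zs)
indices-shift [] ys zs with indices-insert ys zs
... | i , is , eq , ≤is rewrite eq = z≤n ∷ ≤*-suc ≤is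
indices-shift (true ∷ xs) ys zs = ≤-refl ∷ ≤*-suc (indices-shift xs ys zs)
indices-shift (false ∷ xs) ys zs = ≤*-suc (indices-shift xs ys zs)

indices-initial : ∀ xs → indices (replicate (ones xs) true) ≤* indices xs
indices-initial [] = []
indices-initial (true ∷ xs) = z≤n ∷ ≤*-suc (indices-initial xs)
indices-initial (false ∷ xs) = ≤*-trans (indices-initial xs) (≤*-map-suc (indices xs))

indices-gap : ∀ a b → indices (replicate a true ++ false ∷ replicate b true) ≤* map suc (indices (replicate (a + b) true))
indices-gap zero b = Pointwise.refl ≤-refl
indices-gap (suc a) b = z≤n ∷ ≤*-suc (indices-gap a b)

indices-falses : ∀ xs m → indices (xs ++ replicate m false) ≡ indices xs
indices-falses [] zero = refl
indices-falses [] (suc m) = cong (map suc) (indices-falses [] m)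
indices-falses (true ∷ xs) m = cong (λ is → 0 ∷ map suc is) (indices-falses xs m)
indices-falses (false ∷ xs) m = cong (map suc) (indices-falses xs m)

subset : ∀ {n} (xs : List Bool) → length xs ≡ n → Subset n
subset xs eq = cast eq (fromList xs)

toList-subset : ∀ {n} xs (eq : length xs ≡ n) → toList (subset xs eq) ≡ xs
toList-subset xs eq = trans (toList-cast eq (fromList xs)) (toList∘fromList xs)

reverse-split : ∀ (P Q R : List Bool) x y → reverse (P ++ x ∷ Q ++ y ∷ R) ≡ reverse R ++ y ∷ reverse Q ++ x ∷ reverse P
reverse-split P Q R x y = begin
  reverse (P ++ x ∷ Q ++ y ∷ R)
    ≡⟨ reverse-++ P (x ∷ Q ++ y ∷ R) ⟩
  reverse (x ∷ Q ++ y ∷ R) ++ reverse P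
    ≡⟨ cong (_++ reverse P) (unfold-reverse x (Q ++ y ∷ R)) ⟩
  (reverse (Q ++ y ∷ R) ++ x ∷ []) ++ reverse P
    ≡⟨ cong (λ L → (L ++ x ∷ []) ++ reverse P) (trans (reverse-++ Q (y ∷ R)) (cong (_++ reverse Q) (unfold-reverse y R))) ⟩
  (((reverse R ++ y ∷ []) ++ reverse Q) ++ x ∷ []) ++ reverse P
    ≡⟨ ++-assoc ((reverse R ++ y ∷ []) ++ reverse Q) (x ∷ []) (reverse P) ⟩
  ((reverse R ++ y ∷ []) ++ reverse Q) ++ x ∷ reverse P
    ≡⟨ ++-assoc (reverse R ++ y ∷ []) (reverse Q) (x ∷ reverse P) ⟩
  (reverse R ++ y ∷ []) ++ reverse Q ++ x ∷ reverse P
    ≡⟨ ++-assoc (reverse R) (y ∷ []) (reverse Q ++ x ∷ reverse P) ⟩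
  reverse R ++ y ∷ reverse Q ++ x ∷ reverse P ∎
  where open ≡-Reasoning

length-++-∷ : ∀ (xs : List Bool) {x y ys zs} → length ys ≡ length zs → length (xs ++ x ∷ ys) ≡ length (xs ++ y ∷ zs)
length-++-∷ [] eq = cong suc eq
length-++-∷ (_ ∷ xs) eq = cong suc (length-++-∷ xs eq)

initial-shifted : ∀ {n k} {𝓐 : List (Subset n)} → IsKFamily k 𝓐 → Initial k 𝓐 → Shifted (map word 𝓐)
initial-shifted {n} {k} {𝓐} kf ini P Q R X∈ with ∈-map⁻ word X∈
... | X , X∈𝓐 , PQR≡wordX = subst (_∈ map word 𝓐) word-Y (∈-map⁺ word (ini Y X ∣Y∣≡k Y≺X X∈𝓐))
  where
    moved : List Bool
    moved = P ++ false ∷ Q ++ true ∷ R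
    length-moved : length (reverse moved) ≡ n
    length-moved = begin
      length (reverse moved)              ≡⟨ length-reverse moved ⟩
      length moved                        ≡⟨ length-++-∷ P (length-++-∷ Q refl) ⟩
      length (P ++ true ∷ Q ++ false ∷ R) ≡⟨ cong length PQR≡wordX ⟩
      length (word X)                     ≡⟨ length-word X ⟩
      n ∎
      where open ≡-Reasoning
    Y : Subset n
    Y = subset (reverse moved) length-moved
    toList-Y : toList Y ≡ reverse R ++ true ∷ reverse Q ++ false ∷ reverse P
    toList-Y = trans (toList-subset (reverse moved) length-moved) (reverse-split P Q R false true)
    toList-X : toList X ≡ reverse R ++ false ∷ reverse Q ++ true ∷ reverse P
    toList-X = trans (sym (reverse-involutive (toList X)))
                     (trans (cong reverse (sym PQR≡wordX)) (reverse-split P Q R true false))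
    word-Y : word Y ≡ moved
    word-Y = trans (cong reverse (toList-subset (reverse moved) length-moved)) (reverse-involutive moved)
    ∣Y∣≡k : ∣ Y ∣ ≡ k
    ∣Y∣≡k = begin
      ∣ Y ∣                                                    ≡⟨ ones-toList Y ⟨
      ones (toList Y)                                          ≡⟨ cong ones toList-Y ⟩
      ones (reverse R ++ true ∷ reverse Q ++ false ∷ reverse P) ≡⟨ ones-swap (reverse R) (reverse Q) (reverse P) ⟨
      ones (reverse R ++ false ∷ reverse Q ++ true ∷ reverse P) ≡⟨ cong ones toList-X ⟨
      ones (toList X)                                          ≡⟨ ones-toList X ⟩
      ∣ X ∣                                                    ≡⟨ kf X X∈𝓐 ⟩
      k ∎
      where open ≡-Reasoning
    Y≺X : Y ≺ X
    Y≺X = subst₂ _≤*_ (sym (trans (elems-toList Y) (cong indices toList-Y)))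
                      (sym (trans (elems-toList X) (cong indices toList-X)))
                      (indices-shift (reverse R) (reverse Q) (reverse P))

gap : ℕ → ℕ → List Bool
gap a b = replicate a true ++ false ∷ replicate b true

length-gap : ∀ a b → length (gap a b) ≡ suc (a + b)
length-gap a b = trans (length-++ (replicate a true))
                       (trans (cong₂ _+_ (length-replicate a) (cong suc (length-replicate b))) (+-suc a b))

ones-gap : ∀ a b → ones (gap a b) ≡ a + b
ones-gap a b = trans (ones-++ (replicate a true) (false ∷ replicate b true))
                     (cong₂ _+_ (trans (ones-replicate a true) (*-identityʳ a))
                                (trans (ones-replicate b true) (*-identityʳ b)))

gap-avoiding : ∀ k ys → length ys ≡ suc k → ones ys ≤ 1 → ∃₂ λ a b → a + b ≡ k × ¬ Intersect (gap a b) ys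
gap-avoiding k (true ∷ ys) _ (s≤s ones≤0) =
  0 , k , refl , λ { (next p) → ¬intersect-ones≡0 ys (n≤0⇒n≡0 ones≤0) p }
gap-avoiding zero (false ∷ []) _ _ = 0 , 0 , refl , λ { (next ()) }
gap-avoiding (suc k) (false ∷ ys) eq ones≤1 with gap-avoiding k ys (suc-injective eq) ones≤1
... | a , b , a+b≡k , ¬p = suc a , b , cong suc a+b≡k , λ { (next p) → ¬p p }

toList-∉zero : ∀ {n} (X : Subset (suc n)) → zero ∉ X → ∃ λ xs → toList X ≡ false ∷ xs
toList-∉zero (true ∷ X) 0∉X = ⊥-elim (0∉X here-at)
toList-∉zero (false ∷ X) _ = toList X , refl

nonTrivial-initial⇒two-low : ∀ {n k} {𝓐 𝓑 : List (Subset (suc n))} → k + 1 ≤ suc n →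
  IsKFamily k 𝓐 → NonTrivial 𝓐 → Initial k 𝓐 → CrossIntersecting 𝓐 𝓑 →
  ∀ {Y} → Y ∈ 𝓑 → 2 ≤ ones (take (k + 1) (toList Y))
nonTrivial-initial⇒two-low {n} {k} {𝓐} c≤n kf nt ini cr {Y} Y∈ =
  decidable-stable (2 ≤? ones (take c (toList Y))) λ 2≰ → avoid (gap-avoiding k _ length-low (≤-pred (≰⇒> 2≰)))
  where
    c : ℕ
    c = k + 1
    length-low : length (take c (toList Y)) ≡ suc k
    length-low = trans (length-take c (toList Y))
                       (trans (m≤n⇒m⊓n≡m (≤-trans c≤n (≤-reflexive (sym (length-toList Y))))) (+-comm k 1))
    X₀ : Subset (suc n)
    X₀ = proj₁ (nt zero)
    L₀ : List Bool
    L₀ = proj₁ (toList-∉zero X₀ (proj₂ (proj₂ (nt zero))))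
    toList-X₀ : toList X₀ ≡ false ∷ L₀
    toList-X₀ = proj₂ (toList-∉zero X₀ (proj₂ (proj₂ (nt zero))))
    ones-L₀ : ones L₀ ≡ k
    ones-L₀ = trans (cong ones (sym toList-X₀)) (trans (ones-toList X₀) (kf X₀ (proj₁ (proj₂ (nt zero)))))
    avoid : (∃₂ λ a b → a + b ≡ k × ¬ Intersect (gap a b) (take c (toList Y))) → ⊥
    avoid (a , b , a+b≡k , ¬gap∩Y) = ¬Z∩Y (intersect-toList Z Y (cr Z Y Z∈𝓐 Y∈))
      where
        zs : List Bool
        zs = gap a b ++ replicate (suc n ∸ c) false
        length-zs : length zs ≡ suc n
        length-zs = trans (length-++ (gap a b))
                      (trans (cong₂ _+_ (trans (length-gap a b) (trans (cong suc a+b≡k) (+-comm 1 k)))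
                                        (length-replicate (suc n ∸ c)))
                             (m+[n∸m]≡n c≤n))
        Z : Subset (suc n)
        Z = subset zs length-zs
        toList-Z : toList Z ≡ zs
        toList-Z = toList-subset zs length-zs
        ∣Z∣≡k : ∣ Z ∣ ≡ k
        ∣Z∣≡k = begin
          ∣ Z ∣                                               ≡⟨ ones-toList Z ⟨
          ones (toList Z)                                     ≡⟨ cong ones toList-Z ⟩
          ones (gap a b ++ replicate (suc n ∸ c) false)       ≡⟨ ones-++ (gap a b) _ ⟩
          ones (gap a b) + ones (replicate (suc n ∸ c) false) ≡⟨ cong₂ _+_ (ones-gap a b) (ones-replicate (suc n ∸ c) false) ⟩
          a + b + (suc n ∸ c) * 0                             ≡⟨ cong (a + b +_) (*-zeroʳ (suc n ∸ c)) ⟩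
          a + b + 0                                           ≡⟨ +-identityʳ (a + b) ⟩
          a + b                                               ≡⟨ a+b≡k ⟩
          k ∎
          where open ≡-Reasoning
        Z≺X₀ : Z ≺ X₀
        Z≺X₀ = subst₂ _≤*_
          (sym (trans (elems-toList Z) (trans (cong indices toList-Z) (indices-falses (gap a b) _))))
          (sym (trans (elems-toList X₀) (cong indices toList-X₀)))
          (≤*-trans (indices-gap a b)
                    (subst (λ m → map suc (indices (replicate m true)) ≤* map suc (indices L₀))
                           (trans ones-L₀ (sym a+b≡k)) (≤*-suc (indices-initial L₀))))
        Z∈𝓐 : Z ∈ 𝓐
        Z∈𝓐 = ini Z X₀ ∣Z∣≡k Z≺X₀ (proj₁ (proj₂ (nt zero)))
        ¬Z∩Y : ¬ Intersect (toList Z) (toList Y)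
        ¬Z∩Y Z∩Y with intersect-++⁻ (gap a b) (trans (length-gap a b) (trans (cong suc a+b≡k) (sym length-low)))
                        (subst₂ Intersect toList-Z (sym (take++drop≡id c (toList Y))) Z∩Y)
        ... | inj₁ p = ¬gap∩Y p
        ... | inj₂ p = ¬intersect-falses (suc n ∸ c) p

words-admissible : ∀ {n k} {𝓐 𝓑 : List (Subset (suc n))} → k + 1 ≤ suc n →
  IsKFamily k 𝓐 → NonTrivial 𝓐 → Initial k 𝓐 → IsKFamily k 𝓑 → CrossIntersecting 𝓐 𝓑 →
  All (LowBlock.Admissible (k + 1) (suc n) k 2) (map word 𝓑)
words-admissible {k = k} c≤n kA ntA iA kB cr = Allₚ.map⁺ (All.tabulate λ {Y} Y∈ →
  LowBlock.admissible (length-word Y) (trans (ones-word Y) (kB Y Y∈))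
    (subst (2 ≤_) (sym (low-reverse (k + 1) (toList Y))) (nonTrivial-initial⇒two-low c≤n kA ntA iA cr Y∈)))

crossIntersecting-sym : ∀ {n} {𝓐 𝓑 : List (Subset n)} → CrossIntersecting 𝓐 𝓑 → CrossIntersecting 𝓑 𝓐
crossIntersecting-sym cr G F G∈ F∈ = subst Nonempty (∩-comm F G) (cr F G F∈ G∈)

theorem1p5 : (n k : ℕ) → 4 ≤ 2 * k → 2 * k ≤ n →
    (𝓕 𝓖 : List (Subset n)) →
    Unique 𝓕 → Unique 𝓖 → IsKFamily k 𝓕 → IsKFamily k 𝓖 →
    NonTrivial 𝓕 → NonTrivial 𝓖 → CrossIntersecting 𝓕 𝓖 →
    Initial k 𝓕 → Initial k 𝓖 →
    length 𝓕 + length 𝓖 ≤ bound n k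
theorem1p5 n zero () _
theorem1p5 n (suc zero) (s≤s (s≤s ())) _
theorem1p5 zero (suc (suc e)) _ ()
theorem1p5 (suc n) k@(suc (suc e)) _ 2k≤n 𝓕 𝓖 uF uG kF kG ntF ntG cr iF iG = begin
  length 𝓕 + length 𝓖
    ≡⟨ cong₂ _+_ (length-map word 𝓕) (length-map word 𝓖) ⟨
  length (map word 𝓕) + length (map word 𝓖)
    ≤⟨ critical-cross-bound (suc n) (Unique.map⁺ word-injective uF) (Unique.map⁺ word-injective uG)
         (words-admissible c≤n kG ntG iG kF (crossIntersecting-sym cr)) (words-admissible c≤n kF ntF iF kG cr)
         (word-cross cr) (initial-shifted kF iF) k+k≤n ⟩
  k + 1 + count (suc n) k 2
    ≡⟨ cong (k + 1 +_) (count≡bound-sum c≤n) ⟩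
  bound (suc n) k ∎
  where
    open ≤-Reasoning
    open Critical e using (critical-cross-bound; count≡bound-sum)
    open LowBlock (k + 1) using (count)
    k+k≤n : k + k ≤ suc n
    k+k≤n = subst (_≤ suc n) (cong (k +_) (+-identityʳ k)) 2k≤n
    c≤n : k + 1 ≤ suc n
    c≤n = ≤-trans (+-monoʳ-≤ k (s≤s z≤n)) k+k≤n
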